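{- Let $G$ be a finite simple connected outerplane graph with $\Delta(G)=4$ and minimum degree $\delta(G)=2$ which contains neither of the following configurations: (C1) two adjacent vertices of degree 2; (C2) a 3-face $[u_1u_2u_3]$ with $d(u_1)=2$ and $d(u_2)=3$. Then $G$ contains a chain of 3-faces $\{[u_1u_2u_3],[u_3u_4u_5],\ldots,[u_{2t-1}u_{2t}u_{2t+1}]\}$ (with $t\ge 2$) such that $(u_1,u_{2t+1})$ is an inner edge.
   Context: An outerplane graph is a planar drawing of a graph in which all vertices lie on the boundary of one face, the outer face; the other faces are inner faces. Edges on the boundary of the outer face are outer edges; all other edges are inner edges. A $k$-face is a face with $k$ vertices on its boundary; $[w_1w_2\cdots w_k]$ denotes a face whose boundary is the cycle $w_1w_2\cdots w_kw_1$. $d(w)$ is the degree of $w$. A chain of 3-faces is a sequence $\{[u_1u_2u_3],[u_3u_4u_5],\ldots,[u_{2t-1}u_{2t}u_{2t+1}]\}$ with $t\ge 2$ of 3-faces such that for each $i=1,\ldots,t$, the edges $(u_{2i-1},u_{2i})$ and $(u_{2i},u_{2i+1})$ lie on the outer face and $(u_{2i-1},u_{2i+1})$ is an inner edge. -}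

module Defs where

open import Data.Nat using (ℕ; zero; suc; _+_; _*_; _<_; _≤_)
open import Data.Fin as F using (Fin)
open import Data.Bool using (Bool; true; false; if_then_else_)
open import Data.List using (List; map; allFin)
open import Data.Nat.ListAction using (sum)
open import Data.Product using (Σ; ∃; ∃-syntax; _×_; _,_)
open import Data.Sum using (_⊎_)
open import Data.Empty using (⊥)
open import Relation.Nullary using (¬_)
open import Relation.Binary.PropositionalEquality using (_≡_; _≢_)

-- Every outerplane drawing of a (finite, simple, connected) graph is
-- equivalent (as a plane graph, outer face preserved) to a convex drawing:
-- the vertices are placed on a circle, in the cyclic order 0,1,…,n-1
-- (order of first appearance on the outer boundary walk), and edges are
-- non-crossing chords.  Conversely every such drawing is outerplane.
-- So an outerplane graph is: a finite simple graph on Fin n, with the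
-- vertex order being the circular order, and no two crossing chords.

record OuterplaneGraph : Set where
  field
    n        : ℕ
    adj      : Fin n → Fin n → Bool
    symmetric  : ∀ u v → adj u v ≡ adj v u
    irreflexive : ∀ u → adj u u ≡ false
    noncrossing : ∀ (a b c d : Fin n) → a F.< b → b F.< c → c F.< d →
                  adj a c ≡ true → adj b d ≡ true → ⊥

module _ (G : OuterplaneGraph) where
  open OuterplaneGraph G

  Vertex : Set
  Vertex = Fin n

  Adj : Vertex → Vertex → Set
  Adj u v = adj u v ≡ true

  deg : Vertex → ℕ
  deg v = sum (map (λ w → if adj v w then 1 else 0) (allFin n))

  data Walk : Vertex → Vertex → Set where
    here : ∀ {v} → Walk v v
    step : ∀ {u w v} → Adj u w → Walk w v → Walk u v

  Connected : Set
  Connected = ∀ u v → Walk u v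

  MaxDegree : ℕ → Set
  MaxDegree k = (∀ v → deg v ≤ k) × (∃[ v ] deg v ≡ k)

  MinDegree : ℕ → Set
  MinDegree k = (∀ v → k ≤ deg v) × (∃[ v ] deg v ≡ k)

  -- The two open arcs of the circle determined by the chord uv.
  Between : Vertex → Vertex → Vertex → Set
  Between u v k = (u F.< k × k F.< v) ⊎ (v F.< k × k F.< u)

  Outside : Vertex → Vertex → Vertex → Set
  Outside u v k = ¬ Between u v k × k ≢ u × k ≢ v

  data WalkIn (S : Vertex → Set) : Vertex → Vertex → Set where
    last : ∀ {x y} → Adj x y → WalkIn S x y
    cons : ∀ {x z y} → Adj x z → S z → WalkIn S z y → WalkIn S x y

  -- The face of the drawing lying on the S-side of the chord uv is bounded
  -- (an inner face) iff u and v are joined by a walk whose inner vertices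
  -- all lie strictly on that side (closing a cycle with uv there).
  SideBounded : (Vertex → Set) → Vertex → Vertex → Set
  SideBounded S u v = ∃[ z ] (S z × Adj u z × WalkIn S z v)

  InnerEdge : Vertex → Vertex → Set
  InnerEdge u v = Adj u v × SideBounded (Between u v) u v
                          × SideBounded (Outside u v) u v

  OuterEdge : Vertex → Vertex → Set
  OuterEdge u v = Adj u v × ¬ InnerEdge u v

  -- 3-face [u1 u2 u3].  In an outerplane graph every triangle bounds an
  -- inner face (no vertex or edge can lie inside it), so a 3-face is a
  -- triangle of G.
  ThreeFace : Vertex → Vertex → Vertex → Set
  ThreeFace a b c = Adj a b × Adj b c × Adj c a

  C1 : Set
  C1 = ∃[ u ] ∃[ v ] (Adj u v × deg u ≡ 2 × deg v ≡ 2)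

  C2 : Set
  C2 = ∃[ u₁ ] ∃[ u₂ ] ∃[ u₃ ] (ThreeFace u₁ u₂ u₃ × deg u₁ ≡ 2 × deg u₂ ≡ 3)

  -- A chain of 3-faces {[u₁u₂u₃],…,[u_{2t-1}u_{2t}u_{2t+1}]}, t ≥ 2, given
  -- by a sequence u with (0-based) indices 0..2t of pairwise distinct
  -- vertices: the i-th face (i < t) is [u(2i) u(2i+1) u(2i+2)], with
  -- u(2i)u(2i+1), u(2i+1)u(2i+2) outer edges and u(2i)u(2i+2) inner.
  IsChain : ℕ → (ℕ → Vertex) → Set
  IsChain t u =
      2 ≤ t
    × (∀ a b → a ≤ 2 * t → b ≤ 2 * t → u a ≡ u b → a ≡ b)
    × (∀ i → i < t →
          ThreeFace (u (2 * i)) (u (suc (2 * i))) (u (suc (suc (2 * i))))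
        × OuterEdge (u (2 * i)) (u (suc (2 * i)))
        × OuterEdge (u (suc (2 * i))) (u (suc (suc (2 * i))))
        × InnerEdge (u (2 * i)) (u (suc (suc (2 * i)))))

  HasClosedChain : Set
  HasClosedChain = ∃[ t ] ∃[ u ] (IsChain t u × InnerEdge (u 0) (u (2 * t)))

{-# OPTIONS --safe #-}
-- Number the vertices 0, …, n−1 along the outer face.  Call [c, r] a pocket at c
-- if no edge leaves [c, r] from a vertex of (c, r]; the whole graph is a pocket
-- at 0, and a pocket at its right end is a pocket at its left end of the mirror
-- image.  We induct on the width of a pocket [c, r].  If some boundary edge
-- k(k+1) of [c, r] is missing, an innermost edge spanning the gap, or the lack
-- of one, cuts off a narrower pocket.  Otherwise the boundary path c…r is
-- present; taking the least x with a chord x r, either [x, r] is a narrower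
-- pocket or x = c and c…r is a polygon.  In the polygon, take an innermost chord
-- p q that is not an ear chord (one of the form x(x+2) with d(x+1) = 2).  Every
-- chord strictly inside it is an ear chord, and forbidding C1 and C2 forces the
-- ears to sit at p, p+2, p+4, … up to q: a chain of 3-faces closed by the inner
-- edge p q.
module Submission where

open import Defs
open import Algebra.Properties.CommutativeMonoid.Sum using (∑-permute)
open import Data.Bool using (Bool; true; false; if_then_else_)
import Data.Bool.Properties as Bool
open import Data.Empty using (⊥; ⊥-elim)
open import Data.Fin as F using (Fin; toℕ; opposite)
import Data.Fin.Permutation as Perm
open import Data.Fin.Properties as FinP using (toℕ-injective)
open import Data.List using (List; []; _∷_; length; tabulate; applyUpTo)
open import Data.List.Membership.Propositional using (_∈_; _─_)
open import Data.List.Membership.Propositional.Properties using (∈-applyUpTo⁺)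
open import Data.List.Properties using (map-tabulate; length-removeAt′; length-applyUpTo)
open import Data.List.Relation.Unary.Any using (here; there; index)
open import Data.Nat using (ℕ; zero; suc; pred; _+_; _*_; _∸_; _≤_; _<_; z≤n; s≤s; _≤?_; _<?_)
open import Data.Nat.Induction using (<-rec)
open import Data.Nat.ListAction using (sum)
open import Data.Nat.Properties
open import Data.Product using (∃; ∃₂; _×_; _,_; proj₁; proj₂; map₂)
open import Data.Sum using (_⊎_; inj₁; inj₂; [_,_]′)
open import Function using (_∘_; id; case_of_)
open import Function.Definitions using (Injective)
open import Relation.Binary.PropositionalEquality
open import Relation.Nullary using (¬_; Dec; yes; no)
open import Relation.Nullary.Decidable using (_×-dec_; _⊎-dec_; ¬?; map′; decidable-stable)

open import Algebra.Properties.CommutativeMonoid.Sum +-0-commutativeMonoid using (sum-syntax)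

least-witness : {P : ℕ → Set} → (∀ i → Dec (P i)) →
                ∀ {x} → P x → ∃ λ y → P y × (∀ {z} → z < y → ¬ P z)
least-witness {P} P? {x} = <-rec Least search x
  where
  Least : ℕ → Set
  Least x = P x → ∃ λ y → P y × (∀ {z} → z < y → ¬ P z)
  search : ∀ x → (∀ {y} → y < x → Least y) → Least x
  search x smaller px with anyUpTo? P? x
  ... | yes (y , y<x , py) = smaller y<x py
  ... | no none-below = x , px , λ z<x pz → none-below (_ , z<x , pz)

StrictlyInside : ℕ → ℕ → ℕ → ℕ → Set
StrictlyInside x′ y′ x y = x ≤ x′ × y′ ≤ y × (x < x′ ⊎ y′ < y)

StrictlyInside? : ∀ x′ y′ x y → Dec (StrictlyInside x′ y′ x y)
StrictlyInside? x′ y′ x y = (x ≤? x′) ×-dec (y′ ≤? y) ×-dec ((x <? x′) ⊎-dec (y′ <? y))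

width-shrinks : ∀ {x y x′ y′} → StrictlyInside x′ y′ x y → x′ ≤ y′ → y′ ∸ x′ < y ∸ x
width-shrinks {x′ = x′} (_ , y′≤y , inj₁ x<x′) x′≤y′ =
  ≤-<-trans (∸-monoˡ-≤ x′ y′≤y) (∸-monoʳ-< x<x′ (≤-trans x′≤y′ y′≤y))
width-shrinks {y = y} (x≤x′ , _ , inj₂ y′<y) x′≤y′ =
  <-≤-trans (∸-monoˡ-< y′<y x′≤y′) (∸-monoʳ-≤ y x≤x′)

module _ {P : ℕ → ℕ → Set} (P? : ∀ x y → Dec (P x y)) (ordered : ∀ {x y} → P x y → x ≤ y) where

  Innermost : ℕ → ℕ → Set
  Innermost x y = P x y × (∀ {x′ y′} → P x′ y′ → ¬ StrictlyInside x′ y′ x y)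

  innermost : ∀ {x y} → P x y → ∃₂ Innermost
  innermost {x} {y} = <-rec OfWidth search (y ∸ x) refl
    where
    OfWidth : ℕ → Set
    OfWidth g = ∀ {x y} → y ∸ x ≡ g → P x y → ∃₂ Innermost
    search : ∀ g → (∀ {g′} → g′ < g → OfWidth g′) → OfWidth g
    search g smaller {x} {y} refl pxy
      with anyUpTo? (λ x′ → anyUpTo? (λ y′ → P? x′ y′ ×-dec StrictlyInside? x′ y′ x y) (suc y)) (suc y)
    ... | yes (x′ , _ , y′ , _ , px′y′ , inside) = smaller (width-shrinks inside (ordered px′y′)) refl px′y′
    ... | no none-inside = x , y , pxy , λ { {x′} {y′} px′y′ inside@(_ , y′≤y , _) →
          none-inside (x′ , s≤s (≤-trans (ordered px′y′) y′≤y) , y′ , s≤s y′≤y , px′y′ , inside) }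

even-or-odd : ∀ m → ∃ λ t → m ≡ 2 * t ⊎ m ≡ suc (2 * t)
even-or-odd zero = 0 , inj₁ refl
even-or-odd (suc m) with even-or-odd m
... | t , inj₁ m≡2t = t , inj₂ (cong suc m≡2t)
... | t , inj₂ m≡1+2t = suc t , inj₁ (trans (cong suc m≡1+2t) (sym (*-suc 2 t)))

+-2*-suc : ∀ p i → p + 2 * suc i ≡ suc (suc (p + 2 * i))
+-2*-suc p i = trans (cong (p +_) (*-suc 2 i)) (trans (+-suc p _) (cong suc (+-suc p _)))

∈-─ : ∀ {A : Set} {x y : A} {xs : List A} → y ∈ xs → (x∈xs : x ∈ xs) → y ≢ x → y ∈ xs ─ x∈xs
∈-─ (here refl) (here refl) y≢x = ⊥-elim (y≢x refl)
∈-─ (there y∈xs) (here _) _ = y∈xs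
∈-─ (here y≡z) (there _) _ = here y≡z
∈-─ (there y∈xs) (there x∈xs) y≢x = there (∈-─ y∈xs x∈xs y≢x)

∑-indicator-≤-length : ∀ {m} (b : Fin m → Bool) (f : Fin m → ℕ) → Injective _≡_ _≡_ f →
                       (L : List ℕ) → (∀ i → b i ≡ true → f i ∈ L) →
                       ∑[ i < m ] (if b i then 1 else 0) ≤ length L
∑-indicator-≤-length {zero} _ _ _ _ _ = z≤n
∑-indicator-≤-length {suc m} b f f-inj L f∈L with b F.zero in b₀
... | false = ∑-indicator-≤-length (b ∘ F.suc) (f ∘ F.suc) (FinP.suc-injective ∘ f-inj) L (f∈L ∘ F.suc)
... | true = begin
  suc (∑[ i < m ] (if b (F.suc i) then 1 else 0))
    ≤⟨ s≤s (∑-indicator-≤-length (b ∘ F.suc) (f ∘ F.suc) (FinP.suc-injective ∘ f-inj)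
                                  (L ─ f₀∈L) f∈L─f₀) ⟩
  suc (length (L ─ f₀∈L))
    ≡⟨ length-removeAt′ L (index f₀∈L) ⟨
  length L ∎
  where
  open ≤-Reasoning
  f₀∈L : f F.zero ∈ L
  f₀∈L = f∈L F.zero b₀
  f∈L─f₀ : ∀ i → b (F.suc i) ≡ true → f (F.suc i) ∈ L ─ f₀∈L
  f∈L─f₀ i bi = ∈-─ (f∈L (F.suc i) bi) f₀∈L (λ e → case f-inj e of λ ())

sum-tabulate : ∀ {m} (h : Fin m → ℕ) → sum (tabulate h) ≡ ∑[ i < m ] h i
sum-tabulate {zero} h = refl
sum-tabulate {suc m} h = cong (h F.zero +_) (sum-tabulate (h ∘ F.suc))

module _ (G : OuterplaneGraph) where
  open OuterplaneGraph G

  deg-≡-∑ : ∀ v → deg G v ≡ ∑[ w < n ] (if adj v w then 1 else 0)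
  deg-≡-∑ v = trans (cong sum (map-tabulate {n = n} id (λ w → if adj v w then 1 else 0))) (sum-tabulate {n} _)

  deg-≤-length : ∀ v (L : List ℕ) → (∀ w → Adj G v w → toℕ w ∈ L) → deg G v ≤ length L
  deg-≤-length v L h =
    subst (_≤ length L) (sym (deg-≡-∑ v)) (∑-indicator-≤-length (adj v) toℕ toℕ-injective L h)

Admissible : OuterplaneGraph → Set
Admissible G = (∀ v → 2 ≤ deg G v) × ¬ C1 G × ¬ C2 G

ChainFace : (G : OuterplaneGraph) → Vertex G → Vertex G → Vertex G → Set
ChainFace G a b c = ThreeFace G a b c × OuterEdge G a b × OuterEdge G b c × InnerEdge G a c

ChainLink : (G : OuterplaneGraph) → (ℕ → Vertex G) → ℕ → Set
ChainLink G u i = ChainFace G (u (2 * i)) (u (suc (2 * i))) (u (suc (suc (2 * i))))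

-- Vertices are addressed by their position along the outer face; indices out of
-- range are sent to the junk vertex d.
module Indexed (G : OuterplaneGraph) (d : Vertex G) where
  open OuterplaneGraph G

  vx : ℕ → Vertex G
  vx i with i <? n
  ... | yes i<n = F.fromℕ< i<n
  ... | no _ = d

  toℕ-vx : ∀ {i} → i < n → toℕ (vx i) ≡ i
  toℕ-vx {i} i<n with i <? n
  ... | yes i<n′ = FinP.toℕ-fromℕ< i<n′
  ... | no i≮n = ⊥-elim (i≮n i<n)

  vx-toℕ : ∀ u → vx (toℕ u) ≡ u
  vx-toℕ u = toℕ-injective (toℕ-vx (FinP.toℕ<n u))

  vx-< : ∀ {i j} → i < n → j < n → i < j → vx i F.< vx j
  vx-< i<n j<n = subst₂ _<_ (sym (toℕ-vx i<n)) (sym (toℕ-vx j<n))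

  vx-<⁻ : ∀ {i j} → i < n → j < n → vx i F.< vx j → i < j
  vx-<⁻ i<n j<n = subst₂ _<_ (toℕ-vx i<n) (toℕ-vx j<n)

  vx-injective : ∀ {i j} → i < n → j < n → vx i ≡ vx j → i ≡ j
  vx-injective i<n j<n vi≡vj = trans (sym (toℕ-vx i<n)) (trans (cong toℕ vi≡vj) (toℕ-vx j<n))

  vx-≢ : ∀ {i j} → i < n → j < n → i ≢ j → vx i ≢ vx j
  vx-≢ i<n j<n i≢j = i≢j ∘ vx-injective i<n j<n

  E : ℕ → ℕ → Set
  E i j = i < n × j < n × Adj G (vx i) (vx j)

  E? : ∀ i j → Dec (E i j)
  E? i j = (i <? n) ×-dec (j <? n) ×-dec (adj (vx i) (vx j) Bool.≟ true)

  Adj-sym : ∀ {u v} → Adj G u v → Adj G v u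
  Adj-sym = trans (symmetric _ _)

  E-sym : ∀ {i j} → E i j → E j i
  E-sym (i<n , j<n , e) = j<n , i<n , Adj-sym e

  E-≢ : ∀ {i j} → E i j → i ≢ j
  E-≢ (_ , _ , e) refl = case trans (sym e) (irreflexive _) of λ ()

  E-<ˡ : ∀ {i j} → E i j → i < n
  E-<ˡ = proj₁

  E-<ʳ : ∀ {i j} → E i j → j < n
  E-<ʳ = proj₁ ∘ proj₂

  E-adj : ∀ {i j} → E i j → Adj G (vx i) (vx j)
  E-adj = proj₂ ∘ proj₂

  E-noncrossing : ∀ {a b c e} → a < b → b < c → c < e → E a c → E b e → ⊥
  E-noncrossing a<b b<c c<e ac be = noncrossing _ _ _ _
    (vx-< (E-<ˡ ac) (E-<ˡ be) a<b) (vx-< (E-<ˡ be) (E-<ʳ ac) b<c) (vx-< (E-<ʳ ac) (E-<ʳ be) c<e)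
    (E-adj ac) (E-adj be)

  chord-confines : ∀ {x y m w} → E x y → x < m → m < y → E m w → x ≤ w × w ≤ y
  chord-confines xy x<m m<y mw =
      ≮⇒≥ (λ w<x → E-noncrossing w<x x<m m<y (E-sym mw) xy)
    , ≮⇒≥ (λ y<w → E-noncrossing x<m m<y y<w xy mw)

  ≤-non-neighbour : ∀ {k w b} → ¬ E k (suc b) → E k w → w ≤ suc b → w ≤ b
  ≤-non-neighbour k≁ kw w≤ = ≤-pred (≤∧≢⇒< w≤ λ { refl → k≁ kw })

  ≥-non-neighbour : ∀ {k w a} → ¬ E k a → E k w → a ≤ w → suc a ≤ w
  ≥-non-neighbour k≁ kw a≤ = ≤∧≢⇒< a≤ λ { refl → k≁ kw }

  dg : ℕ → ℕ
  dg i = deg G (vx i)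

  dg-≤-length : ∀ {k} (L : List ℕ) → k < n → (∀ w → E k w → w ∈ L) → dg k ≤ length L
  dg-≤-length {k} L k<n h = deg-≤-length G (vx k) L λ w k~w →
    h (toℕ w) (k<n , FinP.toℕ<n w , subst (Adj G (vx k)) (sym (vx-toℕ w)) k~w)

  dg-≤-width : ∀ {a m k} → a ≤ k → k ≤ m + a → m + a < n →
               (∀ w → E k w → a ≤ w × w ≤ m + a) → dg k ≤ m
  dg-≤-width {a} {m} {k} a≤k k≤m+a m+a<n h =
    subst (dg k ≤_) width (dg-≤-length (window ─ k∈window) (≤-<-trans k≤m+a m+a<n) w∈)
    where
    window : List ℕ
    window = applyUpTo (a +_) (suc m)
    ∈window : ∀ {w} → a ≤ w → w ≤ m + a → w ∈ window
    ∈window {w} a≤w w≤m+a = subst (_∈ window) (m+[n∸m]≡n a≤w)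
      (∈-applyUpTo⁺ (a +_) (s≤s (subst (w ∸ a ≤_) (m+n∸n≡m m a) (∸-monoˡ-≤ a w≤m+a))))
    k∈window : k ∈ window
    k∈window = ∈window a≤k k≤m+a
    width : length (window ─ k∈window) ≡ m
    width = suc-injective
      (trans (sym (length-removeAt′ window (index k∈window))) (length-applyUpTo (a +_) (suc m)))
    w∈ : ∀ w → E k w → w ∈ window ─ k∈window
    w∈ w e = ∈-─ (∈window (proj₁ (h w e)) (proj₂ (h w e))) k∈window (E-≢ e ∘ sym)

  WalkIn-snoc : ∀ {S x y z} → WalkIn G S x y → S y → Adj G y z → WalkIn G S x z
  WalkIn-snoc (last e) s e′ = cons e s (last e′)
  WalkIn-snoc (cons e s w) s′ e′ = cons e s (WalkIn-snoc w s′ e′)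

  WalkIn-reverse : ∀ {S x y} → WalkIn G S x y → WalkIn G S y x
  WalkIn-reverse (last e) = last (Adj-sym e)
  WalkIn-reverse (cons e s w) = WalkIn-snoc (WalkIn-reverse w) s (Adj-sym e)

  WalkIn-++ : ∀ {S x y z} → WalkIn G S x y → S y → WalkIn G S y z → WalkIn G S x z
  WalkIn-++ (last e) s w = cons e s w
  WalkIn-++ (cons e s w) s′ w′ = cons e s (WalkIn-++ w s′ w′)

  descending-walk : (S : Vertex G → Set) → ∀ {a b} → a < b → (∀ {k} → a ≤ k → k < b → E k (suc k)) →
                    (∀ {k} → a < k → k < b → S (vx k)) → WalkIn G S (vx b) (vx a)
  descending-walk S {a} {suc b} a<1+b edge inS with m≤n⇒m<n∨m≡n (≤-pred a<1+b)
  ... | inj₂ refl = last (Adj-sym (E-adj (edge ≤-refl ≤-refl)))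
  ... | inj₁ a<b = cons (Adj-sym (E-adj (edge (<⇒≤ a<b) ≤-refl))) (inS a<b ≤-refl)
                     (descending-walk S a<b (λ a≤k k<b → edge a≤k (m<n⇒m<1+n k<b))
                                            (λ a<k k<b → inS a<k (m<n⇒m<1+n k<b)))

  between-vx : ∀ {x y k} → x < k → k < y → y < n → Between G (vx x) (vx y) (vx k)
  between-vx {k = k} x<k k<y y<n = inj₁ (vx-< (<-trans x<k k<n) k<n x<k , vx-< k<n y<n k<y)
    where
    k<n : k < n
    k<n = <-trans k<y y<n

  outside-vx-below : ∀ {x y k} → k < x → x < y → y < n → Outside G (vx x) (vx y) (vx k)
  outside-vx-below {x} {y} {k} k<x x<y y<n =
      (λ { (inj₁ (x<k , _)) → <-asym k<x (vx-<⁻ x<n k<n x<k)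
         ; (inj₂ (y<k , _)) → <-asym (<-trans k<x x<y) (vx-<⁻ y<n k<n y<k) })
    , vx-≢ k<n x<n (<⇒≢ k<x) , vx-≢ k<n y<n (<⇒≢ (<-trans k<x x<y))
    where
    x<n : x < n
    x<n = <-trans x<y y<n
    k<n : k < n
    k<n = <-trans k<x x<n

  outside-vx-above : ∀ {x y k} → x < y → y < k → k < n → Outside G (vx x) (vx y) (vx k)
  outside-vx-above {x} {y} {k} x<y y<k k<n =
      (λ { (inj₁ (_ , k<y)) → <-asym y<k (vx-<⁻ k<n y<n k<y)
         ; (inj₂ (_ , k<x)) → <-asym (<-trans x<y y<k) (vx-<⁻ k<n x<n k<x) })
    , vx-≢ k<n x<n (>⇒≢ (<-trans x<y y<k)) , vx-≢ k<n y<n (>⇒≢ y<k)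
    where
    y<n : y < n
    y<n = <-trans y<k k<n
    x<n : x < n
    x<n = <-trans x<y y<n

  consecutive-outer : ∀ {k} → E k (suc k) → OuterEdge G (vx k) (vx (suc k))
  consecutive-outer {k} e = E-adj e , λ (_ , (z , z-between , _) , _) → nothing-between z z-between
    where
    nothing-between : ∀ z → ¬ Between G (vx k) (vx (suc k)) z
    nothing-between z (inj₁ (k<z , z<1+k)) =
      <⇒≱ (subst (_< toℕ z) (toℕ-vx (E-<ˡ e)) k<z) (≤-pred (subst (toℕ z <_) (toℕ-vx (E-<ʳ e)) z<1+k))
    nothing-between z (inj₂ (1+k<z , z<k)) =
      <-asym (subst (_< toℕ z) (toℕ-vx (E-<ʳ e)) 1+k<z) (m<n⇒m<1+n (subst (toℕ z <_) (toℕ-vx (E-<ˡ e)) z<k))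

  record Pocketʳ (c r : ℕ) : Set where
    field
      c<r : c < r
      r<n : r < n
      confined : ∀ {k w} → c < k → k ≤ r → E k w → c ≤ w × w ≤ r

  record Pocketˡ (l c : ℕ) : Set where
    field
      l<c : l < c
      c<n : c < n
      confined : ∀ {k w} → l ≤ k → k < c → E k w → l ≤ w × w ≤ c

  pred-n<n : pred n < n
  pred-n<n = subst (pred n <_) (suc-pred n {{FinP.nonZeroIndex d}}) ≤-refl

  whole-pocket : 0 < pred n → Pocketʳ 0 (pred n)
  whole-pocket 0<pred-n = record
    { c<r = 0<pred-n ; r<n = pred-n<n ; confined = λ _ _ e → z≤n , pred-mono-≤ (E-<ʳ e) }

  deg-≤-pred-n : ∀ u → deg G u ≤ pred n
  deg-≤-pred-n u = subst (λ v → deg G v ≤ pred n) (vx-toℕ u)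
    (dg-≤-width z≤n (below-top (FinP.toℕ<n u)) (subst (_< n) (sym (+-identityʳ _)) pred-n<n)
                λ w e → z≤n , below-top (E-<ʳ e))
    where
    below-top : ∀ {i} → i < n → i ≤ pred n + 0
    below-top {i} i<n = subst (i ≤_) (sym (+-identityʳ (pred n))) (pred-mono-≤ i<n)

  module _ (H : Admissible G) where

    dg≥2 : ∀ i → 2 ≤ dg i
    dg≥2 i = proj₁ H (vx i)

    dg≤2⇒≡2 : ∀ {k} → dg k ≤ 2 → dg k ≡ 2
    dg≤2⇒≡2 {k} dk≤2 = ≤-antisym dk≤2 (dg≥2 k)

    dg≥3-beside-dg2 : ∀ {u v} → dg u ≡ 2 → E u v → 3 ≤ dg v
    dg≥3-beside-dg2 du e = ≤∧≢⇒< (dg≥2 _) λ 2≡dv → proj₁ (proj₂ H) (vx _ , vx _ , E-adj e , du , sym 2≡dv)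

    dg≥4-at-ear-apex : ∀ {u v w} → dg u ≡ 2 → E u v → E v w → E w u → 4 ≤ dg v
    dg≥4-at-ear-apex du uv vw wu = ≤∧≢⇒< (dg≥3-beside-dg2 du uv) λ 3≡dv →
      proj₂ (proj₂ H) (vx _ , vx _ , vx _ , (E-adj uv , E-adj vw , E-adj wu) , du , sym 3≡dv)

opposite-< : ∀ {m} {i j : Fin m} → i F.< j → opposite j F.< opposite i
opposite-< {i = i} {j} i<j =
  subst₂ _<_ (sym (FinP.opposite-prop j)) (sym (FinP.opposite-prop i)) (∸-monoʳ-< (s≤s i<j) (FinP.toℕ<n j))

opposite-<⁻ : ∀ {m} {i j : Fin m} → opposite i F.< opposite j → j F.< i
opposite-<⁻ {i = i} {j} = subst₂ F._<_ (FinP.opposite-involutive j) (FinP.opposite-involutive i) ∘ opposite-<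

opposite-injective : ∀ {m} {i j : Fin m} → opposite i ≡ opposite j → i ≡ j
opposite-injective {i = i} {j} e =
  trans (sym (FinP.opposite-involutive i)) (trans (cong opposite e) (FinP.opposite-involutive j))

mirror : OuterplaneGraph → OuterplaneGraph
mirror G = record
  { n = n
  ; adj = λ u v → adj (opposite u) (opposite v)
  ; symmetric = λ u v → symmetric _ _
  ; irreflexive = λ u → irreflexive _
  ; noncrossing = λ a b c d a<b b<c c<d ac bd →
      noncrossing (opposite d) (opposite c) (opposite b) (opposite a)
        (opposite-< c<d) (opposite-< b<c) (opposite-< a<b) (trans (symmetric _ _) bd) (trans (symmetric _ _) ac)
  }
  where open OuterplaneGraph G

module _ {G₁ G₂ : OuterplaneGraph} (φ : Vertex G₁ → Vertex G₂)
         (φ-adj : ∀ {a b} → Adj G₁ a b → Adj G₂ (φ a) (φ b)) where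

  WalkIn-map : ∀ {S T} → (∀ {z} → S z → T (φ z)) → ∀ {a b} → WalkIn G₁ S a b → WalkIn G₂ T (φ a) (φ b)
  WalkIn-map S⇒T (last e) = last (φ-adj e)
  WalkIn-map S⇒T (cons e s w) = cons (φ-adj e) (S⇒T s) (WalkIn-map S⇒T w)

  SideBounded-map : ∀ {S T} → (∀ {z} → S z → T (φ z)) →
                    ∀ {a b} → SideBounded G₁ S a b → SideBounded G₂ T (φ a) (φ b)
  SideBounded-map S⇒T (z , s , e , w) = φ z , S⇒T s , φ-adj e , WalkIn-map S⇒T w

  InnerEdge-map : (∀ {x y z} → Between G₁ x y z → Between G₂ (φ x) (φ y) (φ z)) →
                  (∀ {x y z} → Outside G₁ x y z → Outside G₂ (φ x) (φ y) (φ z)) →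
                  ∀ {x y} → InnerEdge G₁ x y → InnerEdge G₂ (φ x) (φ y)
  InnerEdge-map φ-between φ-outside (e , inside , outside) =
    φ-adj e , SideBounded-map φ-between inside , SideBounded-map φ-outside outside

module _ (G : OuterplaneGraph) where
  open OuterplaneGraph G

  deg-mirror : ∀ v → deg (mirror G) v ≡ deg G (opposite v)
  deg-mirror v = begin
    deg (mirror G) v                                            ≡⟨ deg-≡-∑ (mirror G) v ⟩
    ∑[ w < n ] (if adj (opposite v) (opposite w) then 1 else 0)
      ≡⟨ ∑-permute +-0-commutativeMonoid f Perm.reverse ⟨
    ∑[ w < n ] (if adj (opposite v) w then 1 else 0)            ≡⟨ deg-≡-∑ G (opposite v) ⟨
    deg G (opposite v)                                          ∎
    where
    open ≡-Reasoning
    f : Fin n → ℕ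
    f w = if adj (opposite v) w then 1 else 0

  admissible-mirror : Admissible G → Admissible (mirror G)
  admissible-mirror (δ≥2 , no-C1 , no-C2) =
      (λ v → subst (2 ≤_) (sym (deg-mirror v)) (δ≥2 (opposite v)))
    , (λ (u , v , uv , du , dv) → no-C1 (opposite u , opposite v , uv , mirrored du , mirrored dv))
    , (λ (u , v , w , face , du , dv) →
         no-C2 (opposite u , opposite v , opposite w , face , mirrored du , mirrored dv))
    where
    mirrored : ∀ {v k} → deg (mirror G) v ≡ k → deg G (opposite v) ≡ k
    mirrored = trans (sym (deg-mirror _))

  between-opposite : ∀ {x y z} → Between G x y z → Between G (opposite x) (opposite y) (opposite z)
  between-opposite (inj₁ (x<z , z<y)) = inj₂ (opposite-< z<y , opposite-< x<z)
  between-opposite (inj₂ (y<z , z<x)) = inj₁ (opposite-< z<x , opposite-< y<z)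

  between-opposite⁻ : ∀ {x y z} → Between G (opposite x) (opposite y) (opposite z) → Between G x y z
  between-opposite⁻ (inj₁ (x<z , z<y)) = inj₂ (opposite-<⁻ z<y , opposite-<⁻ x<z)
  between-opposite⁻ (inj₂ (y<z , z<x)) = inj₁ (opposite-<⁻ z<x , opposite-<⁻ y<z)

  outside-opposite : ∀ {x y z} → Outside G x y z → Outside G (opposite x) (opposite y) (opposite z)
  outside-opposite (¬between , z≢x , z≢y) =
    ¬between ∘ between-opposite⁻ , z≢x ∘ opposite-injective , z≢y ∘ opposite-injective

  inner-from-mirror : ∀ {x y} → InnerEdge (mirror G) x y → InnerEdge G (opposite x) (opposite y)
  inner-from-mirror = InnerEdge-map opposite id between-opposite outside-opposite

  inner-to-mirror : ∀ {x y} → InnerEdge G (opposite x) (opposite y) → InnerEdge (mirror G) x y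
  inner-to-mirror {x} {y} ie =
    subst₂ (InnerEdge (mirror G)) (FinP.opposite-involutive x) (FinP.opposite-involutive y)
    (InnerEdge-map opposite
      (λ {a} {b} → subst₂ (Adj G) (sym (FinP.opposite-involutive a)) (sym (FinP.opposite-involutive b)))
      between-opposite outside-opposite ie)

  chain-from-mirror : HasClosedChain (mirror G) → HasClosedChain G
  chain-from-mirror (t , u , (2≤t , u-injective , links) , closing) =
      t , opposite ∘ u , (2≤t , (λ a b a≤ b≤ → u-injective a b a≤ b≤ ∘ opposite-injective) , links′)
    , inner-from-mirror closing
    where
    outer-from-mirror : ∀ {x y} → OuterEdge (mirror G) x y → OuterEdge G (opposite x) (opposite y)
    outer-from-mirror (e , ¬inner) = e , ¬inner ∘ inner-to-mirror
    links′ : ∀ i → i < t → ChainLink G (opposite ∘ u) i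
    links′ i i<t with links i i<t
    ... | face , outer₁ , outer₂ , inner =
      face , outer-from-mirror outer₁ , outer-from-mirror outer₂ , inner-from-mirror inner

reflect : ℕ → ℕ → ℕ
reflect n i = n ∸ suc i

reflect-< : ∀ {n i} → i < n → reflect n i < n
reflect-< {suc n} {i} _ = s≤s (m∸n≤m n i)

reflect-involutive : ∀ {n i} → i < n → reflect n (reflect n i) ≡ i
reflect-involutive {suc n} (s≤s i≤n) = m∸[m∸n]≡n i≤n

reflect-mono-< : ∀ {n i j} → i < j → j < n → reflect n j < reflect n i
reflect-mono-< i<j j<n = ∸-monoʳ-< (s≤s i<j) j<n

reflect-mono-≤ : ∀ n {i j} → i ≤ j → reflect n j ≤ reflect n i
reflect-mono-≤ n i≤j = ∸-monoʳ-≤ n (s≤s i≤j)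

reflect-width : ∀ {n l c} → l ≤ c → c < n → reflect n l ∸ reflect n c ≡ c ∸ l
reflect-width {suc n} {l} {c} l≤c (s≤s c≤n) = begin
  (n ∸ l) ∸ (n ∸ c)                        ≡⟨ cong (λ m → m ∸ l ∸ (n ∸ c)) split ⟨
  (l + (c ∸ l) + (n ∸ c)) ∸ l ∸ (n ∸ c)    ≡⟨ cong (λ m → m ∸ l ∸ (n ∸ c)) (+-assoc l _ _) ⟩
  (l + ((c ∸ l) + (n ∸ c))) ∸ l ∸ (n ∸ c)  ≡⟨ cong (_∸ (n ∸ c)) (m+n∸m≡n l _) ⟩
  ((c ∸ l) + (n ∸ c)) ∸ (n ∸ c)            ≡⟨ m+n∸n≡m (c ∸ l) (n ∸ c) ⟩
  c ∸ l                                    ∎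
  where
  open ≡-Reasoning
  split : l + (c ∸ l) + (n ∸ c) ≡ n
  split = trans (cong (_+ (n ∸ c)) (m+[n∸m]≡n l≤c)) (m+[n∸m]≡n c≤n)

module _ (G : OuterplaneGraph) (d : Vertex G) where
  open OuterplaneGraph G
  private
    module G = Indexed G d
    module M = Indexed (mirror G) d

  opposite-vx : ∀ {i} → i < n → opposite (M.vx i) ≡ G.vx (reflect n i)
  opposite-vx {i} i<n = toℕ-injective (begin
    toℕ (opposite (M.vx i))  ≡⟨ FinP.opposite-prop (M.vx i) ⟩
    reflect n (toℕ (M.vx i)) ≡⟨ cong (reflect n) (M.toℕ-vx i<n) ⟩
    reflect n i              ≡⟨ G.toℕ-vx (reflect-< i<n) ⟨
    toℕ (G.vx (reflect n i)) ∎)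
    where open ≡-Reasoning

  E-from-mirror : ∀ {i j} → M.E i j → G.E (reflect n i) (reflect n j)
  E-from-mirror (i<n , j<n , e) =
    reflect-< i<n , reflect-< j<n , subst₂ (Adj G) (opposite-vx i<n) (opposite-vx j<n) e

  pocketˡ-mirror : ∀ {l c} → G.Pocketˡ l c → M.Pocketʳ (reflect n c) (reflect n l)
  pocketˡ-mirror {l} {c} P = record
    { c<r = reflect-mono-< l<c c<n
    ; r<n = reflect-< l<n
    ; confined = confined′
    }
    where
    open G.Pocketˡ P
    l<n : l < n
    l<n = <-trans l<c c<n
    confined′ : ∀ {k w} → reflect n c < k → k ≤ reflect n l → M.E k w →
                reflect n c ≤ w × w ≤ reflect n l
    confined′ {k} {w} c′<k k≤l′ e with confined l≤k′ k′<c (E-from-mirror e)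
      where
      k′<c : reflect n k < c
      k′<c = subst (reflect n k <_) (reflect-involutive c<n) (reflect-mono-< c′<k (M.E-<ˡ e))
      l≤k′ : l ≤ reflect n k
      l≤k′ = subst (_≤ reflect n k) (reflect-involutive l<n) (reflect-mono-≤ n k≤l′)
    ... | l≤w′ , w′≤c = subst (reflect n c ≤_) (reflect-involutive (M.E-<ʳ e)) (reflect-mono-≤ n w′≤c)
                      , subst (_≤ reflect n l) (reflect-involutive (M.E-<ʳ e)) (reflect-mono-≤ n l≤w′)

module PocketStep (G : OuterplaneGraph) (d : Vertex G) (H : Admissible G) {c r : ℕ} (P : Indexed.Pocketʳ G d c r)
  (smallerʳ : ∀ {c′ r′} → Indexed.Pocketʳ G d c′ r′ → r′ ∸ c′ < r ∸ c → HasClosedChain G)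
  (smallerˡ : ∀ {l′ c′} → Indexed.Pocketˡ G d l′ c′ → c′ ∸ l′ < r ∸ c → HasClosedChain G) where

  open OuterplaneGraph G
  open Indexed G d
  open Pocketʳ P

  Span : ℕ → ℕ → ℕ → Set
  Span k x y = c ≤ x × x ≤ k × k < y × y ≤ r × E x y

  Span? : ∀ k x y → Dec (Span k x y)
  Span? k x y = (c ≤? x) ×-dec (x ≤? k) ×-dec (k <? y) ×-dec (y ≤? r) ×-dec E? x y

  span-ordered : ∀ {k x y} → Span k x y → x ≤ y
  span-ordered (_ , x≤k , k<y , _) = ≤-trans x≤k (<⇒≤ k<y)

  span? : ∀ k → Dec (∃₂ (Span k))
  span? k = map′ (λ (x , _ , y , _ , s) → x , y , s)
                 (λ { (x , y , s@(_ , x≤k , k<y , y≤r , _)) →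
                      x , s≤s (≤-trans x≤k (≤-trans (<⇒≤ k<y) y≤r)) , y , s≤s y≤r , s })
                 (anyUpTo? (λ x → anyUpTo? (Span? k x) (suc r)) (suc r))

  innermost-span-chain : ∀ {k x y} → c ≤ k → k < r → ¬ E k (suc k) →
                         Innermost (Span? k) span-ordered x y → HasClosedChain G
  innermost-span-chain {k} {x} {y} c≤k k<r gap ((c≤x , x≤k , k<y , y≤r , xy) , nothing-inside)
    with m≤n⇒m<n∨m≡n x≤k
  ... | inj₁ x<k = smallerʳ pocket (width-shrinks (c≤x , <⇒≤ k<r , inj₂ k<r) (<⇒≤ x<k))
    where
    confined′ : ∀ {m w} → x < m → m ≤ k → E m w → x ≤ w × w ≤ k
    confined′ {m} {w} x<m m≤k mw = x≤w , ≮⇒≥ λ k<w →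
        nothing-inside (≤-trans c≤x (<⇒≤ x<m) , m≤k , k<w , ≤-trans w≤y y≤r , mw) (<⇒≤ x<m , w≤y , inj₁ x<m)
      where
      x≤w : x ≤ w
      x≤w = proj₁ (chord-confines xy x<m (≤-<-trans m≤k k<y) mw)
      w≤y : w ≤ y
      w≤y = proj₂ (chord-confines xy x<m (≤-<-trans m≤k k<y) mw)
    pocket : Pocketʳ x k
    pocket = record { c<r = x<k ; r<n = <-trans k<r r<n ; confined = confined′ }
  ... | inj₂ refl =
    smallerˡ pocket (width-shrinks (≤-trans c≤x (n≤1+n x) , y≤r , inj₁ (s≤s c≤x)) (<⇒≤ 1+x<y))
    where
    1+x<y : suc x < y
    1+x<y = ≤∧≢⇒< k<y λ { refl → gap xy }
    confined′ : ∀ {m w} → suc x ≤ m → m < y → E m w → suc x ≤ w × w ≤ y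
    confined′ {m} {w} x<m m<y mw = ≤∧≢⇒< x≤w x≢w , w≤y
      where
      x≤w : x ≤ w
      x≤w = proj₁ (chord-confines xy x<m m<y mw)
      w≤y : w ≤ y
      w≤y = proj₂ (chord-confines xy x<m m<y mw)
      x≢w : x ≢ w
      x≢w refl =
        nothing-inside (c≤x , ≤-refl , x<m , ≤-trans (<⇒≤ m<y) y≤r , E-sym mw) (≤-refl , <⇒≤ m<y , inj₂ m<y)
    pocket : Pocketˡ (suc x) y
    pocket = record { l<c = 1+x<y ; c<n = E-<ʳ xy ; confined = confined′ }

  unspanned-gap-chain : ∀ {k} → c ≤ k → k < r → ¬ ∃₂ (Span k) → HasClosedChain G
  unspanned-gap-chain {k} c≤k k<r no-span = finish (m≤n⇒m<n∨m≡n k<r)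
    where
    beyond-gap : ∀ {m w} → k < m → m ≤ r → E m w → suc k ≤ w × w ≤ r
    beyond-gap k<m m≤r mw with confined (≤-<-trans c≤k k<m) m≤r mw
    ... | c≤w , w≤r = ≰⇒> (λ w≤k → no-span (_ , _ , c≤w , w≤k , k<m , m≤r , E-sym mw)) , w≤r
    finish : suc k < r ⊎ suc k ≡ r → HasClosedChain G
    finish (inj₁ 1+k<r) =
      smallerʳ pocket (width-shrinks (≤-trans c≤k (n≤1+n k) , ≤-refl , inj₁ (s≤s c≤k)) (<⇒≤ 1+k<r))
      where
      pocket : Pocketʳ (suc k) r
      pocket = record { c<r = 1+k<r ; r<n = r<n ; confined = beyond-gap ∘ <-trans (n<1+n k) }
    finish (inj₂ refl) =
      case ≤-trans (dg≥2 H r) (dg-≤-width {m = 0} ≤-refl ≤-refl r<n λ _ → beyond-gap ≤-refl ≤-refl) of λ ()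

  gap-chain : ∀ {k} → c ≤ k → k < r → ¬ E k (suc k) → HasClosedChain G
  gap-chain {k} c≤k k<r gap with span? k
  ... | no no-span = unspanned-gap-chain c≤k k<r no-span
  ... | yes (_ , _ , s) with innermost (Span? k) span-ordered s
  ...   | _ , _ , innermost-span = innermost-span-chain c≤k k<r gap innermost-span

  module Boundary (path : ∀ {k} → c ≤ k → k < r → E k (suc k)) where

    module Polygon (cr : E c r) where

      polygon-size : 3 + c ≤ r
      polygon-size = ≮⇒≥ λ r<3+c →
        [ triangle-impossible , square-impossible ]′ (m≤n⇒m<n∨m≡n (≤-pred r<3+c))
        where
        r-window : ∀ {m} → r ≤ m + c → ∀ w → E r w → c ≤ w × w ≤ m + c
        r-window r≤m+c w rw = map₂ (λ w≤r → ≤-trans w≤r r≤m+c) (confined c<r ≤-refl rw)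
        triangle-impossible : r < 2 + c → ⊥
        triangle-impossible r<2+c =
          <⇒≱ (dg≥2 H r) (dg-≤-width (<⇒≤ c<r) (≤-pred r<2+c) (≤-<-trans c<r r<n) (r-window (≤-pred r<2+c)))
        square-impossible : r ≡ 2 + c → ⊥
        square-impossible refl = <⇒≱ (dg≥3-beside-dg2 H dg[c+1]≡2 (path (n≤1+n c) ≤-refl))
                                      (dg-≤-width (<⇒≤ c<r) ≤-refl r<n (r-window ≤-refl))
          where
          dg[c+1]≡2 : dg (suc c) ≡ 2
          dg[c+1]≡2 = dg≤2⇒≡2 H (dg-≤-width (n≤1+n c) (n≤1+n _) r<n λ w e → confined ≤-refl (n≤1+n _) e)

      Out : ℕ → ℕ → Vertex G → Set
      Out x y = Outside G (vx x) (vx y)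

      r-to-y : ∀ {x y} → c ≤ x → x < y → y < r → WalkIn G (Out x y) (vx r) (vx y)
      r-to-y c≤x x<y y<r = descending-walk _ y<r (λ y≤k → path (≤-trans c≤x (≤-trans (<⇒≤ x<y) y≤k)))
                                                 (λ y<k k<r → outside-vx-above x<y y<k (<-trans k<r r<n))

      c-to-y : ∀ {x y} → c ≤ x → x < y → y ≤ r → WalkIn G (Out x y) (vx c) (vx y)
      c-to-y c≤x x<y y≤r with m≤n⇒m<n∨m≡n y≤r
      ... | inj₁ y<r = cons (E-adj cr) (outside-vx-above x<y y<r r<n) (r-to-y c≤x x<y y<r)
      ... | inj₂ refl = last (E-adj cr)

      outer-side-below : ∀ {x y} → c < x → x < y → y ≤ r → SideBounded G (Out x y) (vx x) (vx y)
      outer-side-below {suc x′} {y} (s≤s c≤x′) x<y y≤r =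
          vx x′ , outside-vx-below (n<1+n x′) x<y y<n , E-adj (E-sym (path c≤x′ (<-trans (n<1+n x′) x<r)))
        , x′-to-y (m≤n⇒m<n∨m≡n c≤x′)
        where
        y<n : y < n
        y<n = ≤-<-trans y≤r r<n
        x<r : suc x′ < r
        x<r = <-≤-trans x<y y≤r
        x′-to-y : c < x′ ⊎ c ≡ x′ → WalkIn G (Out (suc x′) y) (vx x′) (vx y)
        x′-to-y (inj₁ c<x′) = WalkIn-++
          (descending-walk _ c<x′ (λ c≤k k<x′ → path c≤k (<-trans k<x′ (<-trans (n<1+n x′) x<r)))
                                  (λ c<k k<x′ → outside-vx-below (<-trans k<x′ (n<1+n x′)) x<y y<n))
          (outside-vx-below (s≤s c≤x′) x<y y<n) (c-to-y (≤-trans c≤x′ (n≤1+n x′)) x<y y≤r)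
        x′-to-y (inj₂ refl) = c-to-y (n≤1+n c) x<y y≤r

      outer-side : ∀ {x y} → c ≤ x → x < y → y ≤ r → c < x ⊎ y < r → SideBounded G (Out x y) (vx x) (vx y)
      outer-side c≤x x<y y≤r (inj₁ c<x) = outer-side-below c<x x<y y≤r
      outer-side c≤x x<y y≤r (inj₂ y<r) with m≤n⇒m<n∨m≡n c≤x
      ... | inj₁ c<x = outer-side-below c<x x<y y≤r
      ... | inj₂ refl = vx r , outside-vx-above x<y y<r r<n , E-adj cr , r-to-y c≤x x<y y<r

      polygon-chord-inner : ∀ {x y} → c ≤ x → suc x < y → y ≤ r → E x y → c < x ⊎ y < r →
                            InnerEdge G (vx x) (vx y)
      polygon-chord-inner {x} {y} c≤x 1+x<y y≤r xy not-cr =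
        E-adj xy , inner-side , outer-side c≤x x<y y≤r not-cr
        where
        y<n : y < n
        y<n = ≤-<-trans y≤r r<n
        x<y : x < y
        x<y = <-trans (n<1+n x) 1+x<y
        inner-side : SideBounded G (Between G (vx x) (vx y)) (vx x) (vx y)
        inner-side = vx (suc x) , between-vx (n<1+n x) 1+x<y y<n , E-adj (path c≤x (<-≤-trans x<y y≤r)) ,
          WalkIn-reverse (descending-walk _ 1+x<y
            (λ 1+x≤k k<y → path (≤-trans c≤x (≤-trans (n≤1+n x) 1+x≤k)) (<-≤-trans k<y y≤r))
            (λ 1+x<k k<y → between-vx (<-trans (n<1+n x) 1+x<k) k<y y<n))

      ear-face : ∀ {j} → c ≤ j → 2 + j ≤ r → E j (2 + j) → ChainFace G (vx j) (vx (suc j)) (vx (2 + j))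
      ear-face {j} c≤j j+2≤r j~j+2 =
          (E-adj j~j+1 , E-adj j+1~j+2 , E-adj (E-sym j~j+2))
        , consecutive-outer j~j+1 , consecutive-outer j+1~j+2
        , polygon-chord-inner c≤j ≤-refl j+2≤r j~j+2 proper
        where
        j~j+1 : E j (suc j)
        j~j+1 = path c≤j (≤-trans (n≤1+n _) j+2≤r)
        j+1~j+2 : E (suc j) (2 + j)
        j+1~j+2 = path (≤-trans c≤j (n≤1+n j)) j+2≤r
        proper : c < j ⊎ 2 + j < r
        proper with m≤n⇒m<n∨m≡n c≤j
        ... | inj₁ c<j = inj₁ c<j
        ... | inj₂ refl = inj₂ polygon-size

      EarChord : ℕ → ℕ → Set
      EarChord x y = y ≡ 2 + x × dg (suc x) ≡ 2

      NonEar : ℕ → ℕ → Set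
      NonEar x y = c ≤ x × 2 + x ≤ y × y ≤ r × E x y × ¬ EarChord x y

      NonEar? : ∀ x y → Dec (NonEar x y)
      NonEar? x y =
        (c ≤? x) ×-dec (2 + x ≤? y) ×-dec (y ≤? r) ×-dec E? x y ×-dec
        ¬? ((y ≟ 2 + x) ×-dec (dg (suc x) ≟ 2))

      nonEar-ordered : ∀ {x y} → NonEar x y → x ≤ y
      nonEar-ordered (_ , x+2≤y , _) = ≤-trans (n≤1+n _) (≤-trans (n≤1+n _) x+2≤y)

      module Fan {p q : ℕ} (fan : Innermost NonEar? nonEar-ordered p q) where

        c≤p : c ≤ p
        c≤p = proj₁ (proj₁ fan)
        p+2≤q : 2 + p ≤ q
        p+2≤q = proj₁ (proj₂ (proj₁ fan))
        q≤r : q ≤ r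
        q≤r = proj₁ (proj₂ (proj₂ (proj₁ fan)))
        pq : E p q
        pq = proj₁ (proj₂ (proj₂ (proj₂ (proj₁ fan))))
        pq-not-ear : ¬ EarChord p q
        pq-not-ear = proj₂ (proj₂ (proj₂ (proj₂ (proj₁ fan))))

        q<n : q < n
        q<n = ≤-<-trans q≤r r<n

        p≤q : p ≤ q
        p≤q = ≤-trans (n≤1+n p) (≤-trans (n≤1+n _) p+2≤q)

        path-inside : ∀ {k} → p ≤ k → k < q → E k (suc k)
        path-inside p≤k k<q = path (≤-trans c≤p p≤k) (<-≤-trans k<q q≤r)

        inner-chord-is-ear : ∀ {x y} → StrictlyInside x y p q → 2 + x ≤ y → E x y → EarChord x y
        inner-chord-is-ear inside@(p≤x , y≤q , _) x+2≤y xy =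
          decidable-stable ((_ ≟ _) ×-dec (dg _ ≟ 2)) λ not-ear →
            proj₂ fan (≤-trans c≤p p≤x , x+2≤y , ≤-trans y≤q q≤r , xy , not-ear) inside

        fan-confined : ∀ {k w} → p < k → k < q → E k w → p ≤ w × w ≤ q
        fan-confined = chord-confines pq

        reach-≤ : ∀ {k w} → p < k → k < q → E k w → w ≤ 2 + k
        reach-≤ {k} {w} p<k k<q kw = ≮⇒≥ λ k+2<w →
          <-irrefl (sym (proj₁ (inner-chord-is-ear (<⇒≤ p<k , w≤q , inj₁ p<k) (<⇒≤ k+2<w) kw))) k+2<w
          where
          w≤q : w ≤ q
          w≤q = proj₂ (fan-confined p<k k<q kw)

        reach-≥ : ∀ {k w} → p < k → k < q → E k w → k ≤ 2 + w
        reach-≥ {k} {w} p<k k<q kw = ≮⇒≥ λ w+2<k →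
          <-irrefl (sym (proj₁ (inner-chord-is-ear (p≤w , <⇒≤ k<q , inj₂ k<q) (<⇒≤ w+2<k) (E-sym kw)))) w+2<k
          where
          p≤w : p ≤ w
          p≤w = proj₁ (fan-confined p<k k<q kw)

        fan-size : 3 + p ≤ q
        fan-size with m≤n⇒m<n∨m≡n p+2≤q
        ... | inj₁ p+2<q = p+2<q
        ... | inj₂ refl = ⊥-elim (pq-not-ear (refl , dg≤2⇒≡2 H (dg-≤-width (n≤1+n p) (n≤1+n _) q<n λ w e →
                                                   fan-confined ≤-refl (n<1+n _) e)))

        Ear : ℕ → Set
        Ear j = E j (2 + j) × dg (suc j) ≡ 2 × 2 + j ≤ q

        p+1-window : ∀ w → E (1 + p) w → p ≤ w × w ≤ 3 + p
        p+1-window w e = proj₁ (fan-confined ≤-refl p+2≤q e) , reach-≤ ≤-refl p+2≤q e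

        p+1≁p+3 : ¬ E (1 + p) (3 + p)
        p+1≁p+3 e = <⇒≱ (dg≥4-at-ear-apex H dg[p+2]≡2 (E-sym (path-inside (n≤1+n p) p+2≤q)) e
                                          (E-sym (path-inside (≤-trans (n≤1+n p) (n≤1+n _)) fan-size)))
                        (dg-≤-width (n≤1+n p) (≤-trans (n≤1+n _) (n≤1+n _)) (≤-<-trans fan-size q<n) p+1-window)
          where
          dg[p+2]≡2 : dg (2 + p) ≡ 2
          dg[p+2]≡2 =
            proj₂ (inner-chord-is-ear (n≤1+n p , proj₂ (fan-confined ≤-refl p+2≤q e) , inj₁ ≤-refl) ≤-refl e)

        dg[p+1]≡2 : dg (1 + p) ≡ 2
        dg[p+1]≡2 = dg≤2⇒≡2 H (dg-≤-width (n≤1+n p) (n≤1+n _) (≤-<-trans p+2≤q q<n) λ w e →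
                      proj₁ (p+1-window w e) , ≤-non-neighbour p+1≁p+3 e (proj₂ (p+1-window w e)))

        p~p+2 : E p (2 + p)
        p~p+2 = decidable-stable (E? _ _) λ p≁p+2 → p+2-impossible p≁p+2 (E? (2 + p) (4 + p))
          where
          p<p+2 : p < 2 + p
          p<p+2 = n≤1+n (suc p)
          p+2-window : ¬ E p (2 + p) → ∀ w → E (2 + p) w → 1 + p ≤ w × w ≤ 3 + (1 + p)
          p+2-window p≁p+2 w e = ≥-non-neighbour (p≁p+2 ∘ E-sym) e (≤-pred (≤-pred (reach-≥ p<p+2 fan-size e)))
                               , reach-≤ p<p+2 fan-size e
          p+2-impossible : ¬ E p (2 + p) → Dec (E (2 + p) (4 + p)) → ⊥
          p+2-impossible p≁p+2 (no p+2≁p+4) =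
            <⇒≱ (dg≥3-beside-dg2 H dg[p+1]≡2 (path-inside (n≤1+n p) p+2≤q))
                (dg-≤-width (n≤1+n _) (n≤1+n _) (≤-<-trans fan-size q<n) λ w e →
                   proj₁ (p+2-window p≁p+2 w e) , ≤-non-neighbour p+2≁p+4 e (proj₂ (p+2-window p≁p+2 w e)))
          p+2-impossible p≁p+2 (yes p+2~p+4) =
            <⇒≱ (dg≥4-at-ear-apex H dg[p+3]≡2 (E-sym (path-inside p≤p+2 fan-size)) p+2~p+4
                                    (E-sym (path-inside (≤-trans p≤p+2 (n≤1+n _)) p+4≤q)))
                (dg-≤-width (n≤1+n _) (≤-trans (n≤1+n _) (n≤1+n _)) (≤-<-trans p+4≤q q<n) (p+2-window p≁p+2))
            where
            p≤p+2 : p ≤ 2 + p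
            p≤p+2 = <⇒≤ p<p+2
            p+4≤q : 4 + p ≤ q
            p+4≤q = proj₂ (fan-confined p<p+2 fan-size p+2~p+4)
            dg[p+3]≡2 : dg (3 + p) ≡ 2
            dg[p+3]≡2 = proj₂ (inner-chord-is-ear (p≤p+2 , p+4≤q , inj₁ p<p+2) ≤-refl p+2~p+4)

        first-ear : Ear p
        first-ear = p~p+2 , dg[p+1]≡2 , <⇒≤ fan-size

        next-ear : ∀ {j} → p ≤ j → Ear j → 2 + j < q → Ear (2 + j)
        next-ear {j} p≤j (j~j+2 , dg[j+1]≡2 , _) j+2<q = k~k+2 , dg[k+1]≡2 , k+2≤q
          where
          k : ℕ
          k = 2 + j
          p<k : p < k
          p<k = s≤s (≤-trans p≤j (n≤1+n j))
          j+1<q : 1 + j < q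
          j+1<q = <-trans (n<1+n _) j+2<q
          k-window : ∀ w → E k w → j ≤ w × w ≤ 4 + j
          k-window w e = ≤-pred (≤-pred (reach-≥ p<k j+2<q e)) , reach-≤ p<k j+2<q e
          k~k+2 : E k (2 + k)
          k~k+2 = decidable-stable (E? _ _) λ k≁k+2 →
            <⇒≱ (dg≥4-at-ear-apex H dg[j+1]≡2 (path-inside (≤-trans p≤j (n≤1+n j)) j+1<q) (E-sym j~j+2)
                                  (path-inside p≤j (<-trans (n<1+n j) j+1<q)))
                (dg-≤-width (≤-trans (n≤1+n j) (n≤1+n _)) (n≤1+n _) (≤-<-trans j+2<q q<n) λ w e →
                   proj₁ (k-window w e) , ≤-non-neighbour k≁k+2 e (proj₂ (k-window w e)))
          k+2≤q : 2 + k ≤ q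
          k+2≤q = proj₂ (fan-confined p<k j+2<q k~k+2)
          dg[k+1]≡2 : dg (suc k) ≡ 2
          dg[k+1]≡2 = proj₂ (inner-chord-is-ear (<⇒≤ p<k , k+2≤q , inj₁ p<k) ≤-refl k~k+2)

        ear-at : ∀ i → p + 2 * i < q → Ear (p + 2 * i)
        ear-at zero _ = subst Ear (sym (+-identityʳ p)) first-ear
        ear-at (suc i) p+2[i+1]<q = subst Ear (sym (+-2*-suc p i)) (next-ear (m≤m+n p _) (ear-at i p+2i<q) p+2i+2<q)
          where
          p+2i+2<q : 2 + (p + 2 * i) < q
          p+2i+2<q = subst (_< q) (+-2*-suc p i) p+2[i+1]<q
          p+2i<q : p + 2 * i < q
          p+2i<q = <-trans (<-trans (n<1+n _) (n<1+n _)) p+2i+2<q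

        fan-halves : ∃ λ t → q ≡ p + 2 * t
        fan-halves with even-or-odd (q ∸ p)
        ... | t , inj₁ q-p≡2t = t , trans (sym (m+[n∸m]≡n p≤q)) (cong (p +_) q-p≡2t)
        ... | t , inj₂ q-p≡1+2t =
          ⊥-elim (1+n≰n (subst (2 + (p + 2 * t) ≤_) q≡1+p+2t (proj₂ (proj₂ (ear-at t p+2t<q)))))
          where
          q≡1+p+2t : q ≡ suc (p + 2 * t)
          q≡1+p+2t = trans (sym (m+[n∸m]≡n p≤q)) (trans (cong (p +_) q-p≡1+2t) (+-suc p _))
          p+2t<q : p + 2 * t < q
          p+2t<q = subst (p + 2 * t <_) (sym q≡1+p+2t) ≤-refl

        fan-long : ∀ {t} → q ≡ p + 2 * t → 2 ≤ t
        fan-long {t} q≡p+2t = ≰⇒> λ t≤1 → 1+n≰n (≤-trans fan-size (q≤2+p t≤1))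
          where
          q≤2+p : t ≤ 1 → q ≤ 2 + p
          q≤2+p t≤1 =
            ≤-trans (≤-reflexive q≡p+2t) (≤-trans (+-monoʳ-≤ p (*-monoʳ-≤ 2 t≤1)) (≤-reflexive (+-comm p 2)))

        last-ear : ∃ λ j → p ≤ j × q ≡ 2 + j × Ear j
        last-ear with fan-halves
        ... | zero , q≡p+0 = ⊥-elim (<⇒≱ (fan-long q≡p+0) z≤n)
        ... | suc t , q≡p+2[t+1] =
          p + 2 * t , m≤m+n p _ , q≡j+2 , ear-at t (subst (p + 2 * t <_) (sym q≡j+2) j<j+2)
          where
          q≡j+2 : q ≡ 2 + (p + 2 * t)
          q≡j+2 = trans q≡p+2[t+1] (+-2*-suc p t)
          j<j+2 : p + 2 * t < 2 + (p + 2 * t)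
          j<j+2 = <-trans (n<1+n _) (n<1+n _)

        whole-polygon-impossible : p ≤ c → r ≤ q → ⊥
        whole-polygon-impossible p≤c r≤q with last-ear
        ... | j , p≤j , refl , (j~j+2 , dg[j+1]≡2 , _) =
          <⇒≱ (dg≥4-at-ear-apex H dg[j+1]≡2 (path-inside (≤-trans p≤j (n≤1+n j)) ≤-refl) (E-sym j~j+2)
                                (path-inside p≤j (<-trans (n<1+n j) (n<1+n _))))
              (dg-≤-length (c ∷ j ∷ suc j ∷ []) q<n q-neighbour)
          where
          c<q : c < 2 + j
          c<q = ≤-<-trans c≤p (≤-trans (n≤1+n _) p+2≤q)
          beside-last-ear : ∀ {w} → c < w → E (2 + j) w → w ∈ j ∷ suc j ∷ []
          beside-last-ear {w} c<w e with m≤n⇒m<n∨m≡n (≤-pred (≤-pred q≤w+2))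
            where
            p<w : p < w
            p<w = ≤-<-trans p≤c c<w
            q≤w+2 : 2 + j ≤ 2 + w
            q≤w+2 = ≮⇒≥ λ w+2<q →
              <-irrefl (sym (proj₁ (inner-chord-is-ear (<⇒≤ p<w , ≤-refl , inj₁ p<w) (<⇒≤ w+2<q) (E-sym e)))) w+2<q
          ... | inj₂ j≡w = here (sym j≡w)
          ... | inj₁ j<w = there (here (≤-antisym (≤-pred w<q) j<w))
            where
            w<q : w < 2 + j
            w<q = ≤∧≢⇒< (≤-trans (proj₂ (confined c<q q≤r e)) r≤q) (E-≢ e ∘ sym)
          q-neighbour : ∀ w → E (2 + j) w → w ∈ c ∷ j ∷ suc j ∷ []
          q-neighbour w e with m≤n⇒m<n∨m≡n (proj₁ (confined c<q q≤r e))
          ... | inj₂ c≡w = here (sym c≡w)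
          ... | inj₁ c<w = there (beside-last-ear c<w e)

        fan-proper : c < p ⊎ q < r
        fan-proper with m≤n⇒m<n∨m≡n c≤p | m≤n⇒m<n∨m≡n q≤r
        ... | inj₁ c<p | _ = inj₁ c<p
        ... | inj₂ _ | inj₁ q<r = inj₂ q<r
        ... | inj₂ c≡p | inj₂ q≡r =
          ⊥-elim (whole-polygon-impossible (≤-reflexive (sym c≡p)) (≤-reflexive (sym q≡r)))

        fan-chain : HasClosedChain G
        fan-chain with fan-halves
        ... | t , q≡p+2t = t , u , (fan-long q≡p+2t , u-injective , links) , closing
          where
          u : ℕ → Vertex G
          u i = vx (p + i)
          u-injective : ∀ a b → a ≤ 2 * t → b ≤ 2 * t → u a ≡ u b → a ≡ b
          u-injective a b a≤2t b≤2t = +-cancelˡ-≡ p a b ∘ vx-injective (in-range a≤2t) (in-range b≤2t)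
            where
            in-range : ∀ {a} → a ≤ 2 * t → p + a < n
            in-range {a} a≤2t = ≤-<-trans (subst (p + a ≤_) (sym q≡p+2t) (+-monoʳ-≤ p a≤2t)) q<n
          links : ∀ i → i < t → ChainLink G u i
          links i i<t = subst₂ (ChainFace G (vx j)) (cong vx (sym (+-suc p _)))
                          (cong vx (sym (trans (+-suc p _) (cong suc (+-suc p _)))))
                          (ear-face (≤-trans c≤p (m≤m+n p _)) (≤-trans j+2≤q q≤r) j~j+2)
            where
            j : ℕ
            j = p + 2 * i
            ear : Ear j
            ear = ear-at i (subst (j <_) (sym q≡p+2t) (+-monoʳ-< p (*-monoʳ-< 2 i<t)))
            j~j+2 : E j (2 + j)
            j~j+2 = proj₁ ear
            j+2≤q : 2 + j ≤ q
            j+2≤q = proj₂ (proj₂ ear)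
          closing : InnerEdge G (u 0) (u (2 * t))
          closing = subst₂ (InnerEdge G) (cong vx (sym (+-identityʳ p))) (cong vx q≡p+2t)
                      (polygon-chord-inner c≤p p+2≤q q≤r pq fan-proper)

      polygon-chain : HasClosedChain G
      polygon-chain with innermost NonEar? nonEar-ordered whole-nonEar
        where
        whole-nonEar : NonEar c r
        whole-nonEar = ≤-refl , ≤-trans (n≤1+n _) polygon-size , ≤-refl , cr ,
                       λ (r≡c+2 , _) → 1+n≰n (subst (3 + c ≤_) r≡c+2 polygon-size)
      ... | _ , _ , fan = Fan.fan-chain fan

    LongChord : ℕ → Set
    LongChord x = c ≤ x × 2 + x ≤ r × E x r

    LongChord? : ∀ x → Dec (LongChord x)
    LongChord? x = (c ≤? x) ×-dec (2 + x ≤? r) ×-dec E? x r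

    no-long-chord-impossible : ¬ (∃ λ x → x < r × LongChord x) → ⊥
    no-long-chord-impossible none =
      <⇒≱ (dg≥2 H r) (dg-≤-length (pred r ∷ []) r<n λ w rw → here (cong pred (1+w≡r rw)))
      where
      1+w≡r : ∀ {w} → E r w → suc w ≡ r
      1+w≡r {w} rw with confined c<r ≤-refl rw
      ... | c≤w , w≤r = ≤-antisym (≤∧≢⇒< w≤r (E-≢ rw ∘ sym)) (≤-pred (≰⇒> short))
        where
        short : ¬ 2 + w ≤ r
        short w+2≤r = none (w , ≤-trans (n≤1+n _) w+2≤r , c≤w , w+2≤r , E-sym rw)

    path-chain : HasClosedChain G
    path-chain with anyUpTo? LongChord? r
    ... | no none = ⊥-elim (no-long-chord-impossible none)
    ... | yes (_ , _ , long) with least-witness LongChord? long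
    ...   | x , (c≤x , x+2≤r , xr) , x-least with m≤n⇒m<n∨m≡n c≤x
    ...     | inj₂ refl = Polygon.polygon-chain xr
    ...     | inj₁ c<x = smallerʳ pocket (width-shrinks (<⇒≤ c<x , ≤-refl , inj₁ c<x) (<⇒≤ x<r))
      where
      x<r : x < r
      x<r = ≤-trans (n≤1+n _) x+2≤r
      confined′ : ∀ {m w} → x < m → m ≤ r → E m w → x ≤ w × w ≤ r
      confined′ {m} {w} x<m m≤r mw with confined (<-trans c<x x<m) m≤r mw
      ... | c≤w , w≤r = ≮⇒≥ w≮x , w≤r
        where
        w≮x : ¬ w < x
        w≮x w<x with m≤n⇒m<n∨m≡n m≤r
        ... | inj₁ m<r = E-noncrossing w<x x<m m<r (E-sym mw) xr
        ... | inj₂ refl = x-least w<x (c≤w , ≤-trans (s≤s (s≤s (<⇒≤ w<x))) x+2≤r , E-sym mw)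
      pocket : Pocketʳ x r
      pocket = record { c<r = x<r ; r<n = r<n ; confined = confined′ }

  pocket-chain : HasClosedChain G
  pocket-chain with anyUpTo? (λ k → (c ≤? k) ×-dec ¬? (E? k (suc k))) r
  ... | yes (k , k<r , c≤k , gap) = gap-chain c≤k k<r gap
  ... | no no-gap =
    Boundary.path-chain λ c≤k k<r → decidable-stable (E? _ _) λ gap → no-gap (_ , k<r , c≤k , gap)

chain-from-pocket : ∀ s (G : OuterplaneGraph) → Admissible G → (d : Vertex G) →
                    ∀ {c r} → Indexed.Pocketʳ G d c r → r ∸ c ≡ s → HasClosedChain G
chain-from-pocket = <-rec _ by-width
  where
  OfWidth : ℕ → Set
  OfWidth s = ∀ G → Admissible G → ∀ d {c r} → Indexed.Pocketʳ G d c r → r ∸ c ≡ s → HasClosedChain G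
  by-width : ∀ s → (∀ {s′} → s′ < s → OfWidth s′) → OfWidth s
  by-width _ smaller G H d {c} {r} P refl = PocketStep.pocket-chain G d H P
    (λ P′ shrinks → smaller shrinks G H d P′ refl)
    (λ P′ shrinks → chain-from-mirror G
      (smaller (subst (_< r ∸ c) (sym (reflect-width (<⇒≤ (l<c P′)) (c<n P′))) shrinks)
               (mirror G) (admissible-mirror G H) d (pocketˡ-mirror G d P′) refl))
    where open Indexed.Pocketˡ

lemma2 : (G : OuterplaneGraph) → Connected G → MaxDegree G 4 → MinDegree G 2 →
    ¬ C1 G → ¬ C2 G → HasClosedChain G
lemma2 G _ _ (δ≥2 , v , _) no-C1 no-C2 =
  chain-from-pocket _ G (δ≥2 , no-C1 , no-C2) v (whole-pocket 0<pred-n) refl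
  where
  open Indexed G v
  0<pred-n : 0 < pred (OuterplaneGraph.n G)
  0<pred-n = ≤-trans (s≤s z≤n) (≤-trans (δ≥2 v) (deg-≤-pred-n v))
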